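{- Let $FX=\mathbb{R}\times X$ on $\mathsf{Set}$, whose final coalgebra is the set $\mathbb{R}^\omega$ of real streams with $t(\sigma)=(\sigma(0),\sigma')$, $\sigma'(n)=\sigma(n+1)$. Let $\Sigma$ be a signature with finitely many operation symbols, each of finite arity, and let $R$ be a bipointed stream SOS specification for $\Sigma$. Let $\alpha:\Sigma(\mathbb{R}^\omega)\to\mathbb{R}^\omega$ be the induced operations, i.e. the unique map with $t\circ\alpha=F[\alpha,\mathrm{id}]\circ\lambda_{\mathbb{R}^\omega}\circ\Sigma\langle t,\mathrm{id}\rangle$ for the natural transformation $\lambda$ determined by $R$. Then the set of eventually periodic streams (streams of the form $vwww\cdots$ with $v\in\mathbb{R}^*$, $w\in\mathbb{R}^+$), which is the rational fixpoint of $F$, is closed under all operations of $\alpha$.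
   Context: A signature $\Sigma$ is identified with the polynomial functor $\Sigma X=\coprod_{f\in\Sigma}X^{|f|}$. A bipointed stream SOS rule for an $n$-ary $f\in\Sigma$ has the form: premises $x_1\xrightarrow{r_1}x_1',\dots,x_n\xrightarrow{r_n}x_n'$, conclusion $f(x_1,\dots,x_n)\xrightarrow{r}t$, where $x_1,\dots,x_n,x_1',\dots,x_n'$ are pairwise distinct variables forming a set $V$, $r,r_1,\dots,r_n\in\mathbb{R}$, and $t$ is either a variable in $V$ or $g(y_1,\dots,y_m)$ for an $m$-ary $g\in\Sigma$ and $y_i\in V$; the rule is triggered by $(r_1,\dots,r_n)$. A bipointed stream SOS specification is a set of such rules such that for each $f\in\Sigma$ and each tuple $(r_1,\dots,r_n)\in\mathbb{R}^{|f|}$ exactly one rule for $f$ is triggered by it. It determines the natural transformation $\lambda_X:\Sigma(\mathbb{R}\times X\times X)\to\mathbb{R}\times(\Sigma X+X)$ sending $f((r_1,x_1',x_1),\dots,(r_n,x_n',x_n))$ to $(r,\ t')$ where the unique triggered rule has conclusion $f(x_1,\dots,x_n)\xrightarrow{r}t$ and $t'$ is $t$ with its variables instantiated accordingly (an element of $\Sigma X$ if $t$ is an operation term, of $X$ if $t$ is a variable). -}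

module Defs where

open import Data.Nat using (ℕ; zero; suc; _%_)
open import Data.Nat.DivMod using (m%n<n)
open import Data.Fin using (Fin; fromℕ<)
open import Data.List using (List; []; _∷_; length; lookup)
open import Data.Vec using (Vec; map)
open import Data.Product using (Σ; _×_; _,_; proj₁; proj₂)
open import Data.Sum using (_⊎_; inj₁; inj₂; [_,_]′)
open import Relation.Binary.PropositionalEquality using (_≡_)

record Signature : Set where
  field
    size  : ℕ
    arity : Fin size → ℕ

module _ (Sig : Signature) where
  open Signature Sig

  Op : Set
  Op = Fin size

  ΣF : Set → Set
  ΣF X = Σ Op (λ f → Vec X (arity f))

  ΣFmap : {X Y : Set} → (X → Y) → ΣF X → ΣF Y
  ΣFmap h (f , xs) = f , map h xs

  -- Variables of a rule for an n-ary symbol: x_i (inj₁ i) and x_i' (inj₂ i).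
  RVar : ℕ → Set
  RVar n = Fin n ⊎ Fin n

  Target : ℕ → Set
  Target n = RVar n ⊎ ΣF (RVar n)

  -- A bipointed stream SOS rule for f over label set A:
  -- premises x_i --r_i--> x_i', conclusion f(x_1..x_n) --r--> t.
  record Rule (A : Set) (f : Op) : Set where
    constructor rule
    field
      triggers : Vec A (arity f)
      label    : A
      target   : Target (arity f)

  record Spec (A : Set) : Set₁ where
    field
      rules  : (f : Op) → Rule A f → Set
      unique : (f : Op) (rs : Vec A (arity f)) →
               Σ (Rule A f) λ ρ → rules f ρ × Rule.triggers ρ ≡ rs ×
                 ((ρ' : Rule A f) → rules f ρ' → Rule.triggers ρ' ≡ rs → ρ' ≡ ρ)

  module _ {A : Set} (R : Spec A) where
    open Spec R

    triggered : (f : Op) → Vec A (arity f) → Rule A f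
    triggered f rs = proj₁ (unique f rs)

    instVar : {X : Set} {n : ℕ} → Vec (A × X × X) n → RVar n → X
    instVar ts (inj₁ i) = proj₂ (proj₂ (Data.Vec.lookup ts i))
    instVar ts (inj₂ i) = proj₁ (proj₂ (Data.Vec.lookup ts i))

    -- λ_X : Σ(A × X × X) → A × (Σ X + X), element (r_i, x_i', x_i).
    lam : {X : Set} → ΣF (A × X × X) → A × (ΣF X ⊎ X)
    lam {X} (f , ts) = Rule.label ρ , inst (Rule.target ρ)
      where
      ρ = triggered f (map proj₁ ts)
      inst : Target (arity f) → ΣF X ⊎ X
      inst (inj₁ v) = inj₂ (instVar ts v)
      inst (inj₂ (g , ys)) = inj₁ (g , map (instVar ts) ys)

-- Streams over A as functions ℕ → A (final coalgebra of F X = A × X,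
-- with equality of streams taken pointwise).
Stream : Set → Set
Stream A = ℕ → A

hd : {A : Set} → Stream A → A
hd σ = σ 0

tl : {A : Set} → Stream A → Stream A
tl σ n = σ (suc n)

-- The stream v w w w ⋯ with w = a ∷ ws nonempty.
cyc : {A : Set} → List A → A → List A → Stream A
cyc (x ∷ v) a ws zero    = x
cyc (x ∷ v) a ws (suc k) = cyc v a ws k
cyc [] a ws k = lookup (a ∷ ws) (fromℕ< (m%n<n k (length (a ∷ ws))))

EventuallyPeriodic : {A : Set} → Stream A → Set
EventuallyPeriodic {A} σ =
  Σ (List A) λ v → Σ A λ a → Σ (List A) λ ws → (k : ℕ) → σ k ≡ cyc v a ws k

IsInducedOps : (Sig : Signature) {A : Set} (R : Spec Sig A) →
               (ΣF Sig (Stream A) → Stream A) → Set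
IsInducedOps Sig {A} R α = (s : ΣF Sig (Stream A)) →
    let res = lam Sig R (ΣFmap Sig (λ σ → hd σ , tl σ , σ) s) in
    (hd (α s) ≡ proj₁ res) ×
    ((k : ℕ) → tl (α s) k ≡ [ α , (λ σ → σ) ]′ (proj₂ res) k)

-- A finite stream system is a finite set of states, each denoting a stream,
-- with a successor map denoting the tail.  By pigeonhole the successor orbit
-- of a state cycles, so every stream it denotes is eventually periodic (3);
-- conversely an eventually periodic stream is denoted by the system of its
-- positions up to the end of the first period.  Finite systems are closed
-- under finite sums and, crucially, under one layer of operations (4): the
-- target of a bipointed rule is a variable or a flat term g(y₁,…,yₘ), so the
-- tail of α(g, ⟦s₁⟧,…,⟦sₙ⟧) is again denoted by a state or a flat term over
-- states.

module Submission where

open import Data.Nat using (ℕ; zero; suc; _+_; _*_; _<_; _<?_; _%_; _/_; s≤s)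
open import Data.Nat.Properties
  using (+-suc; +-assoc; +-comm; m≤m+n; n<1+n; ≤-antisym; ≮⇒≥; m≤n⇒∃[o]m+o≡n)
open import Data.Nat.DivMod using (m%n<n; [m+n]%n≡m%n; m≡m%n+[m/n]*n)
open import Data.Nat.GeneralisedArithmetic using (iterate)
open import Data.Fin using (Fin; zero; suc; toℕ; fromℕ<)
open import Data.Fin.Properties
  using (toℕ<n; toℕ-fromℕ<; fromℕ<-cong; pigeonhole; +↔⊎; *↔×)
open import Data.List using (List; []; _∷_; length; applyUpTo)
open import Data.List.Properties using (length-applyUpTo; lookup-applyUpTo)
open import Data.Vec using (Vec; []; _∷_; lookup; map; tabulate; uncons)
open import Data.Vec.Properties using (lookup-map; map-cong; map-∘; lookup∘tabulate)
open import Data.Product using (Σ; _×_; _,_; proj₁; proj₂; uncurry)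
open import Data.Product.Function.NonDependent.Propositional using (_×-↣_)
open import Data.Sum using (_⊎_; inj₁; inj₂; [_,_]′)
open import Data.Sum.Function.Propositional using (_⊎-↣_)
open import Function.Base using (_∘_)
open import Function.Bundles using (_↣_; _↔_; mk↣; mk↔ₛ′; Injection)
open import Function.Construct.Composition using (_↣-∘_)
open import Function.Construct.Identity using (↣-id)
open import Function.Properties.Inverse using (↔⇒↣; ↔-sym)
open import Relation.Nullary using (yes; no)
open import Relation.Binary.PropositionalEquality
open ≡-Reasoning
open import Defs

-- (1) Eventual periodicity

PeriodicFrom : {A : Set} → ℕ → ℕ → Stream A → Set
PeriodicFrom N P σ = (k : ℕ) → σ (N + suc P + k) ≡ σ (N + k)

-- Index-based eventual periodicity, the form in which periodicity arises
-- from the pigeonhole argument.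
UltimatelyPeriodic : {A : Set} → Stream A → Set
UltimatelyPeriodic σ = Σ ℕ λ N → Σ ℕ λ P → PeriodicFrom N P σ

periodicFrom-resp : {A : Set} {σ τ : Stream A} {N P : ℕ} →
                    σ ≗ τ → PeriodicFrom N P σ → PeriodicFrom N P τ
periodicFrom-resp {N = N} σ≗τ per k =
  trans (sym (σ≗τ (N + _ + k))) (trans (per k) (σ≗τ (N + k)))

cyc-periodicFrom : {A : Set} (v : List A) (a : A) (ws : List A) →
                   PeriodicFrom (length v) (length ws) (cyc v a ws)
cyc-periodicFrom (x ∷ v) a ws k = cyc-periodicFrom v a ws k
cyc-periodicFrom []      a ws k =
  cong (Data.List.lookup (a ∷ ws))
       (fromℕ<-cong _ _ (skip-period k) (m%n<n (L + k) L) (m%n<n k L))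
  where
  L = suc (length ws)
  skip-period : ∀ k → (L + k) % L ≡ k % L
  skip-period k = trans (cong (_% L) (+-comm L k)) ([m+n]%n≡m%n k L)

periodic-mod : {A : Set} {σ : Stream A} (P : ℕ) → PeriodicFrom 0 P σ →
               ∀ m → σ (m % suc P) ≡ σ m
periodic-mod {σ = σ} P per m = begin
  σ (m % n)                 ≡⟨ multiples (m / n) (m % n) ⟨
  σ ((m / n) * n + m % n)   ≡⟨ cong σ (+-comm ((m / n) * n) (m % n)) ⟩
  σ (m % n + (m / n) * n)   ≡⟨ cong σ (m≡m%n+[m/n]*n m n) ⟨
  σ m                       ∎
  where
  n = suc P
  multiples : ∀ q r → σ (q * n + r) ≡ σ r
  multiples zero    r = refl
  multiples (suc q) r =
    trans (cong σ (+-assoc n (q * n) r)) (trans (per (q * n + r)) (multiples q r))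

periodicFrom⇒cyc : {A : Set} (N P : ℕ) (σ : Stream A) → PeriodicFrom N P σ →
  ∀ k → σ k ≡ cyc (applyUpTo σ N) (σ (N + 0)) (applyUpTo (λ i → σ (N + suc i)) P) k
periodicFrom⇒cyc (suc N) P σ per zero    = refl
periodicFrom⇒cyc (suc N) P σ per (suc k) = periodicFrom⇒cyc N P (σ ∘ suc) per k
periodicFrom⇒cyc zero    P σ per k = sym (begin
  Data.List.lookup (applyUpTo σ (suc P)) (fromℕ< k<L) ≡⟨ lookup-applyUpTo σ (suc P) _ ⟩
  σ (toℕ (fromℕ< k<L))                                ≡⟨ cong σ (toℕ-fromℕ< k<L) ⟩
  σ (k % suc (length (applyUpTo (σ ∘ suc) P)))       ≡⟨ cong (λ L → σ (k % suc L))
                                                          (length-applyUpTo (σ ∘ suc) P) ⟩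
  σ (k % suc P)                                     ≡⟨ periodic-mod P per k ⟩
  σ k                                               ∎)
  where
  k<L = m%n<n k (suc (length (applyUpTo (σ ∘ suc) P)))

eventuallyPeriodic⇒ultimately : {A : Set} (σ : Stream A) →
  EventuallyPeriodic σ → UltimatelyPeriodic σ
eventuallyPeriodic⇒ultimately σ (v , a , ws , σ≗cyc) =
  length v , length ws ,
  periodicFrom-resp (sym ∘ σ≗cyc) (cyc-periodicFrom v a ws)

ultimately⇒eventuallyPeriodic : {A : Set} (σ : Stream A) →
  UltimatelyPeriodic σ → EventuallyPeriodic σ
ultimately⇒eventuallyPeriodic σ (N , P , per) =
  applyUpTo σ N , σ (N + 0) , applyUpTo (λ i → σ (N + suc i)) P ,
  periodicFrom⇒cyc N P σ per

-- (2) Finite types and the pigeonhole principle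

Finite : Set → Set
Finite D = Σ ℕ λ m → D ↣ Fin m

finite-Fin : (n : ℕ) → Finite (Fin n)
finite-Fin n = n , ↣-id (Fin n)

finite-↣ : {D E : Set} → D ↣ E → Finite E → Finite D
finite-↣ D↣E (m , E↣Fin) = m , E↣Fin ↣-∘ D↣E

finite-⊎ : {D E : Set} → Finite D → Finite E → Finite (D ⊎ E)
finite-⊎ (m , f) (n , g) = m + n , ↔⇒↣ (↔-sym +↔⊎) ↣-∘ (f ⊎-↣ g)

finite-× : {D E : Set} → Finite D → Finite E → Finite (D × E)
finite-× (m , f) (n , g) = m * n , ↔⇒↣ (↔-sym *↔×) ↣-∘ (f ×-↣ g)

Vec-suc↔ : {D : Set} {n : ℕ} → Vec D (suc n) ↔ (D × Vec D n)
Vec-suc↔ = mk↔ₛ′ uncons (uncurry _∷_) (λ _ → refl) λ { (x ∷ xs) → refl }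

finite-Vec : {D : Set} → Finite D → (n : ℕ) → Finite (Vec D n)
finite-Vec F zero    = 1 , mk↣ {to = λ _ → zero} λ { {[]} {[]} _ → refl }
finite-Vec F (suc n) = finite-↣ (↔⇒↣ Vec-suc↔) (finite-× F (finite-Vec F n))

Σ-Fin-suc↔ : {n : ℕ} {F : Fin (suc n) → Set} →
             Σ (Fin (suc n)) F ↔ (F zero ⊎ Σ (Fin n) (F ∘ suc))
Σ-Fin-suc↔ = mk↔ₛ′ split merge split∘merge merge∘split
  where
  split : Σ (Fin _) _ → _ ⊎ Σ (Fin _) _
  split (zero  , x) = inj₁ x
  split (suc i , x) = inj₂ (i , x)
  merge : _ ⊎ Σ (Fin _) _ → Σ (Fin _) _
  merge (inj₁ x)       = zero , x
  merge (inj₂ (i , x)) = suc i , x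
  split∘merge : ∀ y → split (merge y) ≡ y
  split∘merge (inj₁ x)       = refl
  split∘merge (inj₂ (i , x)) = refl
  merge∘split : ∀ y → merge (split y) ≡ y
  merge∘split (zero  , x) = refl
  merge∘split (suc i , x) = refl

finite-Σ : (n : ℕ) {F : Fin n → Set} → ((i : Fin n) → Finite (F i)) →
           Finite (Σ (Fin n) F)
finite-Σ zero    F = 0 , mk↣ {to = λ { (() , _) }} λ { {() , _} }
finite-Σ (suc n) F =
  finite-↣ (↔⇒↣ Σ-Fin-suc↔) (finite-⊎ (F zero) (finite-Σ n (F ∘ suc)))

recurrence : {D : Set} → Finite D → (x : ℕ → D) →
             Σ ℕ λ N → Σ ℕ λ P → x (N + suc P) ≡ x N
recurrence (m , D↣Fin) x
  with i , j , i<j , same-code ← pigeonhole (n<1+n m) (Injection.to D↣Fin ∘ x ∘ toℕ)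
  with P , i+1+P≡j ← m≤n⇒∃[o]m+o≡n i<j
  = toℕ i , P ,
    trans (cong x (trans (+-suc (toℕ i) P) i+1+P≡j))
          (sym (Injection.injective D↣Fin same-code))

-- (3) Finite stream systems

record FiniteSystem (A : Set) : Set₁ where
  field
    State   : Set
    finite  : Finite State
    next    : State → State
    ⟦_⟧     : State → Stream A
    ⟦⟧-next : (s : State) (k : ℕ) → ⟦ s ⟧ (suc k) ≡ ⟦ next s ⟧ k

  ⟦⟧-drop : (s : State) (m k : ℕ) → ⟦ s ⟧ (m + k) ≡ ⟦ iterate next s m ⟧ k
  ⟦⟧-drop s zero    k = refl
  ⟦⟧-drop s (suc m) k = trans (⟦⟧-next s (m + k)) (⟦⟧-drop (next s) m k)

  -- Every denoted stream is eventually periodic: the successor orbit of a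
  -- state must revisit some state.
  system-periodic : (s : State) → UltimatelyPeriodic ⟦ s ⟧
  system-periodic s with N , P , loop ← recurrence finite (iterate next s) =
    N , P , λ k → begin
      ⟦ s ⟧ (N + suc P + k)                 ≡⟨ ⟦⟧-drop s (N + suc P) k ⟩
      ⟦ iterate next s (N + suc P) ⟧ k      ≡⟨ cong (λ t → ⟦ t ⟧ k) loop ⟩
      ⟦ iterate next s N ⟧ k                ≡⟨ ⟦⟧-drop s N k ⟨
      ⟦ s ⟧ (N + k)                         ∎

open FiniteSystem using (State; ⟦_⟧)

Realizes : {A : Set} → FiniteSystem A → Stream A → Set
Realizes S σ = Σ (State S) λ s → ⟦ S ⟧ s ≗ σ

realized-periodic : {A : Set} (S : FiniteSystem A) {σ : Stream A} →
                    Realizes S σ → UltimatelyPeriodic σ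
realized-periodic S (s , ⟦s⟧≗σ) with N , P , per ← FiniteSystem.system-periodic S s =
  N , P , periodicFrom-resp ⟦s⟧≗σ per

-- An eventually periodic stream is realized by the system of its positions
-- 0 … N+P, where the successor of the last position wraps back to N.
periodic-system : {A : Set} (σ : Stream A) → UltimatelyPeriodic σ → FiniteSystem A
periodic-system {A} σ (N , P , per) = record
  { State = Fin L ; finite = finite-Fin L ; next = advance
  ; ⟦_⟧ = from ; ⟦⟧-next = from-advance }
  where
  L = suc (N + P)
  N<L : N < L
  N<L = s≤s (m≤m+n N P)
  from : Fin L → Stream A
  from p k = σ (toℕ p + k)
  advance : Fin L → Fin L
  advance p with suc (toℕ p) <? L
  ... | yes p+1<L = fromℕ< p+1<L
  ... | no  _     = fromℕ< N<L
  from-advance : (p : Fin L) (k : ℕ) → from p (suc k) ≡ from (advance p) k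
  from-advance p k with suc (toℕ p) <? L
  ... | yes p+1<L = cong σ (trans (+-suc (toℕ p) k)
                                  (cong (_+ k) (sym (toℕ-fromℕ< p+1<L))))
  ... | no  p+1≮L = begin
    σ (toℕ p + suc k)        ≡⟨ cong σ (+-suc (toℕ p) k) ⟩
    σ (suc (toℕ p) + k)      ≡⟨ cong (λ i → σ (i + k)) p+1≡L ⟩
    σ (suc (N + P) + k)      ≡⟨ cong (λ i → σ (i + k)) (+-suc N P) ⟨
    σ (N + suc P + k)        ≡⟨ per k ⟩
    σ (N + k)                ≡⟨ cong (λ i → σ (i + k)) (toℕ-fromℕ< N<L) ⟨
    σ (toℕ (fromℕ< N<L) + k) ∎
    where
    p+1≡L : suc (toℕ p) ≡ L
    p+1≡L = ≤-antisym (toℕ<n p) (≮⇒≥ p+1≮L)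

periodic-system-realizes : {A : Set} (σ : Stream A) (p : UltimatelyPeriodic σ) →
                           Realizes (periodic-system σ p) σ
periodic-system-realizes σ p = zero , λ k → refl

⨁ : {A : Set} (n : ℕ) → (Fin n → FiniteSystem A) → FiniteSystem A
⨁ n S = record
  { State   = Σ (Fin n) (State ∘ S)
  ; finite  = finite-Σ n (FiniteSystem.finite ∘ S)
  ; next    = λ { (i , s) → i , FiniteSystem.next (S i) s }
  ; ⟦_⟧     = λ { (i , s) → ⟦ S i ⟧ s }
  ; ⟦⟧-next = λ { (i , s) → FiniteSystem.⟦⟧-next (S i) s }
  }

⨁-realizes : {A : Set} {n : ℕ} (S : Fin n → FiniteSystem A) (i : Fin n)
             {σ : Stream A} → Realizes (S i) σ → Realizes (⨁ n S) σ
⨁-realizes S i (s , ⟦s⟧≗σ) = (i , s) , ⟦s⟧≗σ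

-- (4) Operations induced by a bipointed specification

module InducedOperations (Sig : Signature) {A : Set} (R : Spec Sig A)
  (α : ΣF Sig (Stream A) → Stream A) (isα : IsInducedOps Sig R α) where

  open Signature Sig using (arity)

  unfold : Stream A → A × Stream A × Stream A
  unfold σ = hd σ , tl σ , σ

  fired : (g : Op Sig) → Vec (Stream A) (arity g) → Rule Sig A g
  fired g xs = triggered Sig R g (map proj₁ (map unfold xs))

  denote : {n : ℕ} → Vec (Stream A) n → RVar Sig n → Stream A
  denote xs (inj₁ j) = lookup xs j
  denote xs (inj₂ j) = tl (lookup xs j)

  instVar-denote : {n : ℕ} (xs : Vec (Stream A) n) (v : RVar Sig n) →
                   instVar Sig R (map unfold xs) v ≡ denote xs v
  instVar-denote xs (inj₁ j) = cong (proj₂ ∘ proj₂) (lookup-map j unfold xs)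
  instVar-denote xs (inj₂ j) = cong (proj₁ ∘ proj₂) (lookup-map j unfold xs)

  continuation : {n : ℕ} → Vec (Stream A) n → Target Sig n → Stream A
  continuation xs (inj₁ v)       = denote xs v
  continuation xs (inj₂ (h , ys)) = α (h , map (denote xs) ys)

  α-tail : (g : Op Sig) (xs : Vec (Stream A) (arity g)) (k : ℕ) →
           α (g , xs) (suc k) ≡ continuation xs (Rule.target (fired g xs)) k
  α-tail g xs k = trans (proj₂ (isα (g , xs)) k) by-target
    where
    by-target : [ α , (λ σ → σ) ]′ (proj₂ (lam Sig R (g , map unfold xs))) k
              ≡ continuation xs (Rule.target (fired g xs)) k
    by-target with Rule.target (fired g xs)
    ... | inj₁ v        = cong-app (instVar-denote xs v) k
    ... | inj₂ (h , ys) = cong (λ zs → α (h , zs) k) (map-cong (instVar-denote xs) ys)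

  _≋_ : {n : ℕ} → Vec (Stream A) n → Vec (Stream A) n → Set
  xs ≋ ys = ∀ j → lookup xs j ≗ lookup ys j

  map-≋ : {B : Set} {m : ℕ} {f g : B → Stream A} →
          (∀ b → f b ≗ g b) → (zs : Vec B m) → map f zs ≋ map g zs
  map-≋ {f = f} {g} f≗g zs j k =
    trans (cong-app (lookup-map j f zs) k)
          (trans (f≗g (lookup zs j) k) (sym (cong-app (lookup-map j g zs) k)))

  heads-cong : {n : ℕ} {xs ys : Vec (Stream A) n} → xs ≋ ys →
               map proj₁ (map unfold xs) ≡ map proj₁ (map unfold ys)
  heads-cong {xs = []}     {[]}     xs≋ys = refl
  heads-cong {xs = x ∷ xs} {y ∷ ys} xs≋ys =
    cong₂ _∷_ (xs≋ys zero 0) (heads-cong (xs≋ys ∘ suc))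

  denote-cong : {n : ℕ} {xs ys : Vec (Stream A) n} → xs ≋ ys →
                (v : RVar Sig n) → denote xs v ≗ denote ys v
  denote-cong xs≋ys (inj₁ j) k = xs≋ys j k
  denote-cong xs≋ys (inj₂ j) k = xs≋ys j (suc k)

  -- α respects pointwise equality of its arguments, by induction on the
  -- position: the head depends only on the argument heads, the tail is a
  -- variable or an α-term one position further back.
  α-cong : (k : ℕ) (g : Op Sig) {xs ys : Vec (Stream A) (arity g)} →
           xs ≋ ys → α (g , xs) k ≡ α (g , ys) k
  α-cong zero g {xs} {ys} xs≋ys = begin
    α (g , xs) 0             ≡⟨ proj₁ (isα (g , xs)) ⟩
    Rule.label (fired g xs)  ≡⟨ cong (Rule.label ∘ triggered Sig R g) (heads-cong xs≋ys) ⟩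
    Rule.label (fired g ys)  ≡⟨ proj₁ (isα (g , ys)) ⟨
    α (g , ys) 0             ∎
  α-cong (suc k) g {xs} {ys} xs≋ys = begin
    α (g , xs) (suc k)                             ≡⟨ α-tail g xs k ⟩
    continuation xs (Rule.target (fired g xs)) k   ≡⟨ cong (λ ρ → continuation xs (Rule.target ρ) k)
                                                        (cong (triggered Sig R g) (heads-cong xs≋ys)) ⟩
    continuation xs (Rule.target (fired g ys)) k   ≡⟨ continuation-cong (Rule.target (fired g ys)) ⟩
    continuation ys (Rule.target (fired g ys)) k   ≡⟨ α-tail g ys k ⟨
    α (g , ys) (suc k)                             ∎
    where
    continuation-cong : (t : Target Sig (arity g)) → continuation xs t k ≡ continuation ys t k
    continuation-cong (inj₁ v)        = denote-cong xs≋ys v k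
    continuation-cong (inj₂ (h , zs)) = α-cong k h (map-≋ (denote-cong xs≋ys) zs)

  -- Since every rule target is a variable or a flat
  -- term, the tail of a flat term's stream is again denoted by a flat term.
  flat-terms : FiniteSystem A → FiniteSystem A
  flat-terms S = record
    { State   = Term
    ; finite  = finite-⊎ (finite-Σ _ (finite-Vec S.finite ∘ arity)) S.finite
    ; next    = step
    ; ⟦_⟧     = eval
    ; ⟦⟧-next = eval-step
    }
    where
    module S = FiniteSystem S
    Term = ΣF Sig S.State ⊎ S.State

    eval : Term → Stream A
    eval (inj₁ (g , ss)) = α (g , map S.⟦_⟧ ss)
    eval (inj₂ s)        = S.⟦ s ⟧

    stepVar : {n : ℕ} → Vec S.State n → RVar Sig n → S.State
    stepVar ss (inj₁ j) = lookup ss j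
    stepVar ss (inj₂ j) = S.next (lookup ss j)

    stepTarget : {n : ℕ} → Vec S.State n → Target Sig n → Term
    stepTarget ss (inj₁ v)        = inj₂ (stepVar ss v)
    stepTarget ss (inj₂ (h , ys)) = inj₁ (h , map (stepVar ss) ys)

    step : Term → Term
    step (inj₁ (g , ss)) = stepTarget ss (Rule.target (fired g (map S.⟦_⟧ ss)))
    step (inj₂ s)        = inj₂ (S.next s)

    stepVar-denote : {n : ℕ} (ss : Vec S.State n) (v : RVar Sig n) →
                     S.⟦ stepVar ss v ⟧ ≗ denote (map S.⟦_⟧ ss) v
    stepVar-denote ss (inj₁ j) k = sym (cong-app (lookup-map j S.⟦_⟧ ss) k)
    stepVar-denote ss (inj₂ j) k =
      trans (sym (S.⟦⟧-next (lookup ss j) k)) (sym (cong-app (lookup-map j S.⟦_⟧ ss) (suc k)))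

    stepTarget-continuation : {n : ℕ} (ss : Vec S.State n) (t : Target Sig n) (k : ℕ) →
                              continuation (map S.⟦_⟧ ss) t k ≡ eval (stepTarget ss t) k
    stepTarget-continuation ss (inj₁ v)        k = sym (stepVar-denote ss v k)
    stepTarget-continuation ss (inj₂ (h , ys)) k = begin
      α (h , map (denote (map S.⟦_⟧ ss)) ys) k       ≡⟨ α-cong k h (map-≋ (λ v → sym ∘ stepVar-denote ss v) ys) ⟩
      α (h , map (S.⟦_⟧ ∘ stepVar ss) ys) k          ≡⟨ cong (λ zs → α (h , zs) k) (map-∘ S.⟦_⟧ (stepVar ss) ys) ⟩
      α (h , map S.⟦_⟧ (map (stepVar ss) ys)) k      ∎

    eval-step : (t : Term) (k : ℕ) → eval t (suc k) ≡ eval (step t) k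
    eval-step (inj₁ (g , ss)) k =
      trans (α-tail g (map S.⟦_⟧ ss) k)
            (stepTarget-continuation ss (Rule.target (fired g (map S.⟦_⟧ ss))) k)
    eval-step (inj₂ s) k = S.⟦⟧-next s k

  flat-terms-realizes : (S : FiniteSystem A) (g : Op Sig) (xs : Vec (Stream A) (arity g)) →
    ((j : Fin (arity g)) → Realizes S (lookup xs j)) → Realizes (flat-terms S) (α (g , xs))
  flat-terms-realizes S g xs realized = inj₁ (g , ss) , λ k → α-cong k g ss≋xs
    where
    ss = tabulate (proj₁ ∘ realized)
    ss≋xs : map (⟦ S ⟧) ss ≋ xs
    ss≋xs j k = begin
      lookup (map (⟦ S ⟧) ss) j k   ≡⟨ cong-app (lookup-map j (⟦ S ⟧) ss) k ⟩
      ⟦ S ⟧ (lookup ss j) k         ≡⟨ cong (λ s → ⟦ S ⟧ s k) (lookup∘tabulate (proj₁ ∘ realized) j) ⟩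
      ⟦ S ⟧ (proj₁ (realized j)) k  ≡⟨ proj₂ (realized j) k ⟩
      lookup xs j k                 ∎

corollary5p1 : (Sig : Signature) {A : Set} (R : Spec Sig A)
    (α : ΣF Sig (Stream A) → Stream A) → IsInducedOps Sig R α →
    (f : Op Sig) (σs : Data.Vec.Vec (Stream A) (Signature.arity Sig f)) →
    ((i : Fin (Signature.arity Sig f)) → EventuallyPeriodic (lookup σs i)) →
    EventuallyPeriodic (α (f , σs))
corollary5p1 Sig {A} R α isα f σs periodic =
  ultimately⇒eventuallyPeriodic (α (f , σs))
    (realized-periodic (flat-terms inputs) (flat-terms-realizes inputs f σs inputs-realize))
  where
  open InducedOperations Sig R α isα
  n = Signature.arity Sig f
  ultimately : (i : Fin n) → UltimatelyPeriodic (lookup σs i)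
  ultimately i = eventuallyPeriodic⇒ultimately (lookup σs i) (periodic i)
  argument : Fin n → FiniteSystem A
  argument i = periodic-system (lookup σs i) (ultimately i)
  inputs : FiniteSystem A
  inputs = ⨁ n argument
  inputs-realize : (i : Fin n) → Realizes inputs (lookup σs i)
  inputs-realize i = ⨁-realizes argument i (periodic-system-realizes (lookup σs i) (ultimately i))
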